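{- There is an absolute constant $C$ such that the following holds. Let $n,k,t$ be positive integers with $t\le\min\{k,\sqrt{d}\}$, where $d=(n/k)^{1/3}$. Let $H$ be a $3$-graph on vertex set $B\cup C_0$ where $B$ and $C_0$ are disjoint, $|B|\le 16td^2$ and $|C_0|\le 16td^2k$. If $H$ has $e\ge Ckn^2$ edges, then $H$ contains a copy of $\mathit{St}_3(d,d)$ whose leaves all lie in $C_0$.
   Context: A $3$-graph is a $3$-uniform hypergraph. $\mathit{St}_3(h,k)$ is the $3$-graph with a vertex $v$ contained in all edges such that removing $v$ from every edge yields $h$ vertex-disjoint copies of the graph star $S_k$ (star with $k$ leaves); its leaves are the $hk$ leaf vertices of these stars. Non-integer quantities are rounded (floors omitted). -}

module Defs where

open import Data.Nat using (ℕ; _+_; _*_; _^_; _≤_; _<_; suc)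
open import Data.Fin using (Fin; toℕ)
open import Data.Fin.Subset using (Subset; ⁅_⁆; _∪_; ∣_∣)
open import Data.List using (List; length)
open import Data.List.Membership.Propositional using (_∈_)
open import Data.List.Relation.Unary.All using (All)
open import Data.List.Relation.Unary.Unique.Propositional using (Unique)
open import Data.Product using (_×_; Σ)
open import Data.Sum using (_⊎_; inj₁; inj₂)
open import Data.Unit using (⊤; tt)
open import Relation.Binary.PropositionalEquality using (_≡_)
open import Function.Definitions using (Injective)

record 3Graph (N : ℕ) : Set where
  field
    edges    : List (Subset N)
    size3    : All (λ s → ∣ s ∣ ≡ 3) edges
    distinct : Unique edges
open 3Graph public

numEdges : ∀ {N} → 3Graph N → ℕ
numEdges H = length (edges H)

triple : ∀ {N} → Fin N → Fin N → Fin N → Subset N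
triple x y z = ⁅ x ⁆ ∪ (⁅ y ⁆ ∪ ⁅ z ⁆)

StVertex : ℕ → ℕ → Set
StVertex h k = ⊤ ⊎ (Fin h ⊎ (Fin h × Fin k))

apex : ∀ {h k} → StVertex h k
apex = inj₁ tt

centre : ∀ {h k} → Fin h → StVertex h k
centre i = inj₂ (inj₁ i)

leaf : ∀ {h k} → Fin h → Fin k → StVertex h k
leaf i j = inj₂ (inj₂ (i Data.Product., j))

record StCopy {N : ℕ} (H : 3Graph N) (h k : ℕ) (P : Fin N → Set) : Set where
  field
    emb        : StVertex h k → Fin N
    emb-inj    : Injective _≡_ _≡_ emb
    emb-edges  : ∀ i j → triple (emb apex) (emb (centre i)) (emb (leaf i j)) ∈ edges H
    leaves-in-P : ∀ i j → P (emb (leaf i j))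

-- Vertex set Fin (b + c): B = first b vertices, C₀ = the remaining c vertices.
InC₀ : ∀ {c} (b : ℕ) → Fin (b + c) → Set
InC₀ b x = b ≤ toℕ x

module Submission where

-- Call the first b vertices B. An edge of H either lies inside B (at most b³ edges) or can
-- be written {v, u, w} with w ∉ B, i.e. as an arc u → w of the link digraph of the apex v.
-- Hence some link digraph has many arcs, and D vertex-disjoint out-stars with D leaves
-- each in it form, together with v, a copy of St₃(D, D) with leaves in C₀.
-- Arcs between vertices outside B come in both directions, so in-degrees exceed out-degrees
-- by at most b. If D vertices have out-degree at least D² + D, the centres and then the
-- leaves are chosen greedily as distinct representatives. Otherwise these few high vertices
-- are deleted, after which every vertex has degree at most 2(D² + D) + b; as long as more
-- than N(D - 1) arcs survive some vertex keeps D out-neighbours, and removing it with D of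
-- them as a new star destroys at most (D + 1)(2(D² + D) + b) arcs. Since b ≤ 64tD²,
-- c ≤ 64tD²k and t² ≤ D, all these losses are O(kn²).

open import Defs
open import Data.Nat using (ℕ; _+_; _*_; _^_; _≤_; _<_; suc; NonZero)
open import Data.Product using (Σ)

open import Data.Nat using (zero; _<ᵇ_; _≤ᵇ_; z≤n; s≤s; >-nonZero⁻¹; _≤?_)
open import Data.Nat.Properties hiding (_≟_)
open import Data.Nat.Tactic.RingSolver using (solve-∀)
open import Data.Bool using (Bool; true; false; _∧_; _∨_; not; T)
import Data.Bool.Properties as Bool
open import Data.Fin using (Fin; zero; suc; toℕ; _≟_; combine; remQuot)
open import Data.Fin.Properties using (toℕ<n; remQuot-combine; combine-injective)
import Data.Fin.Properties as Fin
open import Data.Fin.Subset using (Subset; ⁅_⁆; _∪_; ∣_∣; ⊥)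
open import Data.Fin.Subset.Properties using (∪-comm; ∪-assoc; ∪-identityˡ)
open import Data.Vec using ([]; _∷_)
open import Data.Vec.Properties using (≡-dec)
open import Data.List using (List; []; _∷_; length)
open import Data.List.Membership.Propositional using (_∈_)
open import Data.List.Relation.Unary.Any using (here; there)
import Data.List.Relation.Unary.All as All
open import Data.List.Relation.Unary.AllPairs using ([]; _∷_)
open import Data.List.Relation.Unary.Unique.Propositional using (Unique)
open import Data.Product using (∃-syntax; _×_; _,_; proj₁; proj₂)
open import Data.Sum using (_⊎_; inj₁; inj₂)
open import Data.Empty using (⊥-elim)
open import Data.Unit using (tt)
open import Function using (_∘_)
open import Function.Definitions using (Injective)
open import Relation.Nullary using (¬_; Dec; yes; no; does; ¬?; _×-dec_; contradiction)
open import Relation.Nullary.Decidable using (T?; map′)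
open import Relation.Binary.Definitions using (DecidableEquality)
open import Relation.Binary.PropositionalEquality
open import Algebra.Properties.Semiring.Sum +-*-semiring
  using (sum-syntax; sum-cong-≗; sum-replicate-zero; ∑-distrib-+; ∑-comm; *-distribˡ-sum; *-distribʳ-sum)

-- Indicator sums

∧-elimˡ : ∀ a {b} → T (a ∧ b) → T a
∧-elimˡ true _ = tt

∧-elimʳ : ∀ a {b} → T (a ∧ b) → T b
∧-elimʳ true t = t

∧-intro : ∀ a {b} → T a → T b → T (a ∧ b)
∧-intro true _ t = t

∨-introˡ : ∀ a b → T a → T (a ∨ b)
∨-introˡ true b _ = tt

∨-introʳ : ∀ a b → T b → T (a ∨ b)
∨-introʳ false b t = t
∨-introʳ true  b _ = tt

T-not⇒¬T : ∀ a → T (not a) → ¬ T a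
T-not⇒¬T false _ ()

not-contrapositive : ∀ a b → (T a → T b) → T (not b) → T (not a)
not-contrapositive false b _   _  = tt
not-contrapositive true  b a⇒b nb = ⊥-elim (T-not⇒¬T b nb (a⇒b tt))

does⇒ : ∀ {P : Set} (p? : Dec P) → T (does p?) → P
does⇒ (yes p) _ = p

⇒does : ∀ {P : Set} (p? : Dec P) → P → T (does p?)
⇒does (yes _) _ = tt
⇒does (no ¬p) p = ¬p p

not-does⇒¬ : ∀ {P : Set} (p? : Dec P) → T (not (does p?)) → ¬ P
not-does⇒¬ (no ¬p) _ = ¬p

_==_ : ∀ {n} → Fin n → Fin n → Bool
x == y = does (x ≟ y)

χ : Bool → ℕ
χ false = 0
χ true  = 1

χ≤1 : ∀ a → χ a ≤ 1
χ≤1 false = z≤n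
χ≤1 true  = ≤-refl

χ-positive : ∀ a → 0 < χ a → T a
χ-positive true _ = tt

χ-mono : ∀ {a b} → (T a → T b) → χ a ≤ χ b
χ-mono {false}         _ = z≤n
χ-mono {true} {true}   _ = ≤-refl
χ-mono {true} {false} ab = ⊥-elim (ab tt)

χ-strict : ∀ a b → ¬ T a → T b → χ a < χ b
χ-strict false true _  _ = s≤s z≤n
χ-strict true  b    ¬a _ = ⊥-elim (¬a tt)

χ-mono-⊎ : ∀ a b c → (T a → T b ⊎ T c) → χ a ≤ χ b + χ c
χ-mono-⊎ false b c _ = z≤n
χ-mono-⊎ true  b c a⇒ with a⇒ tt
... | inj₁ tb = ≤-trans (χ-mono {true} {b} (λ _ → tb)) (m≤m+n (χ b) (χ c))
... | inj₂ tc = ≤-trans (χ-mono {true} {c} (λ _ → tc)) (m≤n+m (χ c) (χ b))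

χ-∧ : ∀ a b → χ (a ∧ b) ≡ χ a * χ b
χ-∧ false b = refl
χ-∧ true  b = sym (+-identityʳ (χ b))

χ-∨ : ∀ a b → χ (a ∨ b) ≤ χ a + χ b
χ-∨ false b = ≤-refl
χ-∨ true  b = s≤s z≤n

χ-split : ∀ a e → χ a ≤ χ (a ∧ not e) + χ e
χ-split false e     = z≤n
χ-split true  false = ≤-refl
χ-split true  true  = s≤s z≤n

∑-mono-≤ : ∀ {n} {f g : Fin n → ℕ} → (∀ i → f i ≤ g i) → ∑[ i < n ] f i ≤ ∑[ i < n ] g i
∑-mono-≤ {zero}  f≤g = z≤n
∑-mono-≤ {suc n} f≤g = +-mono-≤ (f≤g zero) (∑-mono-≤ (f≤g ∘ suc))

∑-mono-< : ∀ {n} {f g : Fin n → ℕ} → (∀ i → f i ≤ g i) → ∀ i → f i < g i → ∑[ i < n ] f i < ∑[ i < n ] g i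
∑-mono-< {suc n} f≤g zero    fᵢ<gᵢ = +-mono-<-≤ fᵢ<gᵢ (∑-mono-≤ (f≤g ∘ suc))
∑-mono-< {suc n} f≤g (suc i) fᵢ<gᵢ = +-mono-≤-< (f≤g zero) (∑-mono-< (f≤g ∘ suc) i fᵢ<gᵢ)

∑-const : ∀ n k → ∑[ i < n ] k ≡ n * k
∑-const zero    k = refl
∑-const (suc n) k = cong (k +_) (∑-const n k)

∑-χ≤ : ∀ {n} (P : Fin n → Bool) → ∑[ i < n ] χ (P i) ≤ n
∑-χ≤ {n} P = begin
  ∑[ i < n ] χ (P i) ≤⟨ ∑-mono-≤ (χ≤1 ∘ P) ⟩
  ∑[ i < n ] 1       ≡⟨ ∑-const n 1 ⟩
  n * 1              ≡⟨ *-identityʳ n ⟩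
  n                  ∎
  where open ≤-Reasoning

∑-select : ∀ {n} (x : Fin n) (g : Fin n → ℕ) → ∑[ w < n ] (χ (w == x) * g w) ≡ g x
∑-select {suc n} zero g = begin
  g zero + 0 + ∑[ w < n ] 0 ≡⟨ cong (g zero + 0 +_) (sum-replicate-zero n) ⟩
  g zero + 0 + 0            ≡⟨ +-identityʳ _ ⟩
  g zero + 0                ≡⟨ +-identityʳ _ ⟩
  g zero                    ∎
  where open ≡-Reasoning
∑-select {suc n} (suc x) g = ∑-select x (g ∘ suc)

∑-pigeonhole : ∀ {n} (g : Fin n → ℕ) k → n * k < ∑[ i < n ] g i → ∃[ i ] k < g i
∑-pigeonhole {suc n} g k nk<∑ with k <? g zero
... | yes k<g₀ = zero , k<g₀
... | no  k≮g₀ with ∑-pigeonhole (g ∘ suc) k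
                     (+-cancelˡ-< k _ _ (<-≤-trans nk<∑ (+-monoˡ-≤ _ (≮⇒≥ k≮g₀))))
...   | i , k<gᵢ = suc i , k<gᵢ

∑-positive : ∀ {n} (g : Fin n → ℕ) → 0 < ∑[ i < n ] g i → ∃[ i ] 0 < g i
∑-positive {n} g 0<∑ = ∑-pigeonhole g 0 (subst (_< ∑[ i < n ] g i) (sym (*-zeroʳ n)) 0<∑)

∑-remove-point : ∀ {n} (P : Fin n → Bool) (x : Fin n) →
                 ∑[ w < n ] χ (P w) ≤ ∑[ w < n ] χ (P w ∧ not (w == x)) + 1
∑-remove-point {n} P x = begin
  ∑[ w < n ] χ (P w)                                          ≤⟨ ∑-mono-≤ (λ w → χ-split (P w) (w == x)) ⟩
  ∑[ w < n ] (χ (P w ∧ not (w == x)) + χ (w == x))            ≡⟨ ∑-distrib-+ (λ w → χ (P w ∧ not (w == x))) (λ w → χ (w == x)) ⟩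
  ∑[ w < n ] χ (P w ∧ not (w == x)) + ∑[ w < n ] χ (w == x)   ≡⟨ cong (∑[ w < n ] χ (P w ∧ not (w == x)) +_) point ⟩
  ∑[ w < n ] χ (P w ∧ not (w == x)) + 1                       ∎
  where
  open ≤-Reasoning
  point : ∑[ w < n ] χ (w == x) ≡ 1
  point = trans (sum-cong-≗ (λ w → sym (*-identityʳ (χ (w == x))))) (∑-select x (λ _ → 1))

#below≤ : ∀ n m → ∑[ i < n ] χ (toℕ i <ᵇ m) ≤ m
#below≤ zero    m       = z≤n
#below≤ (suc n) zero    = ≤-reflexive (sum-replicate-zero n)
#below≤ (suc n) (suc m) = s≤s (#below≤ n m)

inImage : ∀ {m n} → (Fin m → Fin n) → Fin n → Bool
inImage {zero}  f x = false
inImage {suc m} f x = (x == f zero) ∨ inImage (f ∘ suc) x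

inImage-intro : ∀ {m n} (f : Fin m → Fin n) j → T (inImage f (f j))
inImage-intro f zero    = ∨-introˡ (f zero == f zero) _ (⇒does (f zero ≟ f zero) refl)
inImage-intro f (suc j) = ∨-introʳ (f (suc j) == f zero) _ (inImage-intro (f ∘ suc) j)

∑-inImage : ∀ {m n} (f : Fin m → Fin n) (w : Fin n → ℕ) →
            ∑[ x < n ] (χ (inImage f x) * w x) ≤ ∑[ j < m ] w (f j)
∑-inImage {zero}  {n} f w = ≤-reflexive (sum-replicate-zero n)
∑-inImage {suc m} {n} f w = begin
  ∑[ x < n ] (χ (inImage f x) * w x)
    ≤⟨ ∑-mono-≤ (λ x → *-monoˡ-≤ (w x) (χ-∨ (x == f zero) (inImage (f ∘ suc) x))) ⟩
  ∑[ x < n ] ((χ (x == f zero) + χ (inImage (f ∘ suc) x)) * w x)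
    ≡⟨ sum-cong-≗ (λ x → *-distribʳ-+ (w x) (χ (x == f zero)) _) ⟩
  ∑[ x < n ] (χ (x == f zero) * w x + χ (inImage (f ∘ suc) x) * w x)
    ≡⟨ ∑-distrib-+ (λ x → χ (x == f zero) * w x) (λ x → χ (inImage (f ∘ suc) x) * w x) ⟩
  ∑[ x < n ] (χ (x == f zero) * w x) + ∑[ x < n ] (χ (inImage (f ∘ suc) x) * w x)
    ≤⟨ +-mono-≤ (≤-reflexive (∑-select (f zero) w)) (∑-inImage (f ∘ suc) w) ⟩
  w (f zero) + ∑[ j < m ] w (f (suc j))
    ∎
  where open ≤-Reasoning

∑-χ-inImage : ∀ {m n} (f : Fin m → Fin n) → ∑[ x < n ] χ (inImage f x) ≤ m
∑-χ-inImage {m} {n} f = begin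
  ∑[ x < n ] χ (inImage f x)       ≡⟨ sum-cong-≗ (λ x → *-identityʳ (χ (inImage f x))) ⟨
  ∑[ x < n ] (χ (inImage f x) * 1) ≤⟨ ∑-inImage f (λ _ → 1) ⟩
  ∑[ j < m ] 1                     ≡⟨ ∑-const m 1 ⟩
  m * 1                            ≡⟨ *-identityʳ m ⟩
  m                                ∎
  where open ≤-Reasoning

-- Greedy systems of distinct representatives

record SDR {m n} (Q : Fin m → Fin n → Bool) : Set where
  field
    rep           : Fin m → Fin n
    rep-injective : Injective _≡_ _≡_ rep
    rep-valid     : ∀ p → T (Q p (rep p))

distinct-representatives : ∀ {m n} (Q : Fin m → Fin n → Bool) →
                           (∀ p → toℕ p < ∑[ w < n ] χ (Q p w)) → SDR Q
distinct-representatives {zero}  Q _ = record { rep = λ () ; rep-injective = λ {} ; rep-valid = λ () }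
distinct-representatives {suc m} {n} Q enough = extend (∑-positive (χ ∘ Q zero) (enough zero))
  where
  extend : ∃[ x ] 0 < χ (Q zero x) → SDR Q
  extend (x , 0<Qx) = record { rep = rep ; rep-injective = injective ; rep-valid = valid }
    where
    Q′ : Fin m → Fin n → Bool
    Q′ p w = Q (suc p) w ∧ not (w == x)
    module R = SDR (distinct-representatives Q′ λ p →
      ≤-pred (subst (suc (toℕ p) <_) (+-comm _ 1) (<-≤-trans (enough (suc p)) (∑-remove-point (Q (suc p)) x))))
    avoids-x : ∀ p → R.rep p ≢ x
    avoids-x p = not-does⇒¬ (R.rep p ≟ x) (∧-elimʳ (Q (suc p) (R.rep p)) (R.rep-valid p))
    rep : Fin (suc m) → Fin n
    rep zero    = x
    rep (suc p) = R.rep p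
    injective : Injective _≡_ _≡_ rep
    injective {zero}  {zero}  _  = refl
    injective {zero}  {suc q} eq = ⊥-elim (avoids-x q (sym eq))
    injective {suc p} {zero}  eq = ⊥-elim (avoids-x p eq)
    injective {suc p} {suc q} eq = cong suc (R.rep-injective eq)
    valid : ∀ p → T (Q p (rep p))
    valid zero    = χ-positive (Q zero x) 0<Qx
    valid (suc p) = ∧-elimˡ (Q (suc p) (R.rep p)) (R.rep-valid p)

-- Disjoint out-stars in a dense digraph

-- With D = d + 1 and R = D² + D: N·d arcs force a vertex with D out-neighbours, each of the
-- D greedy rounds destroys at most (D + 1)(2R + β) arcs, and deleting the fewer than D
-- vertices of out-degree at least R destroys at most d·2N arcs.
starThreshold : ℕ → ℕ → ℕ → ℕ
starThreshold N d β = N * d + D * (suc D * (R + (R + β))) + d * (N + N)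
  where
  D R : ℕ
  D = suc d
  R = D * D + D


module DisjointOutStars {N : ℕ} (A : Fin N → Fin N → Bool) (A-irreflexive : ∀ u → ¬ T (A u u)) (d : ℕ) where

  D : ℕ
  D = suc d

  record Star : Set where
    field
      point           : Fin (suc D) → Fin N
      point-injective : Injective _≡_ _≡_ point
      point-arc       : ∀ j → T (A (point zero) (point (suc j)))

  record Stars (r : ℕ) : Set where
    field
      vertex           : Fin r × Fin (suc D) → Fin N
      vertex-injective : Injective _≡_ _≡_ vertex
      vertex-arc       : ∀ i j → T (A (vertex (i , zero)) (vertex (i , suc j)))

  open Star
  open Stars

  no-stars : Stars 0
  no-stars = record { vertex = λ { (() , _) } ; vertex-injective = λ { {() , _} } ; vertex-arc = λ () }

  add-star : ∀ {r} (s : Star) (ss : Stars r) → (∀ j y → point s j ≢ vertex ss y) → Stars (suc r)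
  add-star {r} s ss disjoint = record { vertex = vertex′ ; vertex-injective = injective ; vertex-arc = arc }
    where
    vertex′ : Fin (suc r) × Fin (suc D) → Fin N
    vertex′ (zero  , j) = point s j
    vertex′ (suc i , j) = vertex ss (i , j)
    injective : Injective _≡_ _≡_ vertex′
    injective {zero  , j} {zero  , j′} eq = cong (zero ,_) (point-injective s eq)
    injective {zero  , j} {suc i′ , j′} eq = ⊥-elim (disjoint j (i′ , j′) eq)
    injective {suc i , j} {zero  , j′} eq = ⊥-elim (disjoint j′ (i , j) (sym eq))
    injective {suc i , j} {suc i′ , j′} eq with vertex-injective ss eq
    ... | refl = refl
    arc : ∀ i j → T (A (vertex′ (i , zero)) (vertex′ (i , suc j)))
    arc zero    = point-arc s
    arc (suc i) = vertex-arc ss i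

  Within : ∀ {r} → (Fin N → Bool) → Stars r → Set
  Within F ss = ∀ y → T (F (vertex ss y))

  star-at : ∀ (F : Fin N → Bool) u → T (not (F u)) → D ≤ ∑[ w < N ] χ (A u w ∧ not (F w)) →
            Σ Star λ s → ∀ j → T (not (F (point s j)))
  star-at F u u-fresh enough = record { point = point′ ; point-injective = injective ; point-arc = arc } , fresh
    where
    module L = SDR (distinct-representatives (λ (_ : Fin D) w → A u w ∧ not (F w))
                                             (λ j → <-≤-trans (toℕ<n j) enough))
    point′ : Fin (suc D) → Fin N
    point′ zero    = u
    point′ (suc j) = L.rep j
    arc : ∀ j → T (A u (L.rep j))
    arc j = ∧-elimˡ (A u (L.rep j)) (L.rep-valid j)
    fresh : ∀ j → T (not (F (point′ j)))
    fresh zero    = u-fresh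
    fresh (suc j) = ∧-elimʳ (A u (L.rep j)) (L.rep-valid j)
    leaf≢u : ∀ j → L.rep j ≢ u
    leaf≢u j eq = A-irreflexive u (subst (T ∘ A u) eq (arc j))
    injective : Injective _≡_ _≡_ point′
    injective {zero}  {zero}   _  = refl
    injective {zero}  {suc j′} eq = ⊥-elim (leaf≢u j′ (sym eq))
    injective {suc j} {zero}   eq = ⊥-elim (leaf≢u j eq)
    injective {suc j} {suc j′} eq = cong suc (L.rep-injective eq)

  outDeg inDeg deg : Fin N → ℕ
  outDeg u = ∑[ w < N ] χ (A u w)
  inDeg  w = ∑[ u < N ] χ (A u w)
  deg    x = outDeg x + inDeg x

  outDegOutside : (Fin N → Bool) → Fin N → ℕ
  outDegOutside F u = ∑[ w < N ] χ (not (F u) ∧ not (F w) ∧ A u w)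

  arcsOutside : (Fin N → Bool) → ℕ
  arcsOutside F = ∑[ u < N ] outDegOutside F u

  lost-arc : ∀ a s b t p → χ (not a ∧ not b ∧ p) ≤ χ (not (a ∨ s) ∧ not (b ∨ t) ∧ p) + χ s * χ p + χ t * χ p
  lost-arc true  s     b     t     p     = z≤n
  lost-arc false s     true  t     p     = z≤n
  lost-arc false s     false t     false = z≤n
  lost-arc false false false false true  = ≤-refl
  lost-arc false true  false t     true  = s≤s z≤n
  lost-arc false false false true  true  = s≤s z≤n

  outDegOutside-∪ : ∀ (F S : Fin N → Bool) u → outDegOutside F u ≤
    outDegOutside (λ x → F x ∨ S x) u + χ (S u) * outDeg u + ∑[ w < N ] (χ (S w) * χ (A u w))
  outDegOutside-∪ F S u = begin
    outDegOutside F u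
      ≤⟨ ∑-mono-≤ (λ w → lost-arc (F u) (S u) (F w) (S w) (A u w)) ⟩
    ∑[ w < N ] (χ (live w) + χ (S u) * χ (A u w) + χ (S w) * χ (A u w))
      ≡⟨ ∑-distrib-+ (λ w → χ (live w) + χ (S u) * χ (A u w)) (λ w → χ (S w) * χ (A u w)) ⟩
    ∑[ w < N ] (χ (live w) + χ (S u) * χ (A u w)) + ∑[ w < N ] (χ (S w) * χ (A u w))
      ≡⟨ cong (_+ ∑[ w < N ] (χ (S w) * χ (A u w))) (∑-distrib-+ (χ ∘ live) (λ w → χ (S u) * χ (A u w))) ⟩
    outDegOutside F′ u + ∑[ w < N ] (χ (S u) * χ (A u w)) + ∑[ w < N ] (χ (S w) * χ (A u w))
      ≡⟨ cong (λ z → outDegOutside F′ u + z + ∑[ w < N ] (χ (S w) * χ (A u w))) (*-distribˡ-sum (χ (S u)) (χ ∘ A u)) ⟨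
    outDegOutside F′ u + χ (S u) * outDeg u + ∑[ w < N ] (χ (S w) * χ (A u w))
      ∎
    where
    open ≤-Reasoning
    F′ : Fin N → Bool
    F′ x = F x ∨ S x
    live : Fin N → Bool
    live w = not (F′ u) ∧ not (F′ w) ∧ A u w

  arcsOutside-∪ : ∀ (F S : Fin N → Bool) → arcsOutside F ≤ arcsOutside (λ x → F x ∨ S x) + ∑[ x < N ] (χ (S x) * deg x)
  arcsOutside-∪ F S = begin
    arcsOutside F
      ≤⟨ ∑-mono-≤ (outDegOutside-∪ F S) ⟩
    ∑[ u < N ] (outDegOutside F′ u + χ (S u) * outDeg u + ∑[ w < N ] (χ (S w) * χ (A u w)))
      ≡⟨ ∑-distrib-+ (λ u → outDegOutside F′ u + χ (S u) * outDeg u) (λ u → ∑[ w < N ] (χ (S w) * χ (A u w))) ⟩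
    ∑[ u < N ] (outDegOutside F′ u + χ (S u) * outDeg u) + ∑[ u < N ] ∑[ w < N ] (χ (S w) * χ (A u w))
      ≡⟨ cong₂ _+_ (∑-distrib-+ (outDegOutside F′) (λ u → χ (S u) * outDeg u)) (∑-comm (λ u w → χ (S w) * χ (A u w))) ⟩
    arcsOutside F′ + ∑[ u < N ] (χ (S u) * outDeg u) + ∑[ w < N ] ∑[ u < N ] (χ (S w) * χ (A u w))
      ≡⟨ cong (λ z → arcsOutside F′ + ∑[ u < N ] (χ (S u) * outDeg u) + z) (sum-cong-≗ (λ w → *-distribˡ-sum (χ (S w)) (λ u → χ (A u w)))) ⟨
    arcsOutside F′ + ∑[ u < N ] (χ (S u) * outDeg u) + ∑[ w < N ] (χ (S w) * inDeg w)
      ≡⟨ +-assoc (arcsOutside F′) _ _ ⟩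
    arcsOutside F′ + (∑[ u < N ] (χ (S u) * outDeg u) + ∑[ w < N ] (χ (S w) * inDeg w))
      ≡⟨ cong (arcsOutside F′ +_) (∑-distrib-+ (λ x → χ (S x) * outDeg x) (λ x → χ (S x) * inDeg x)) ⟨
    arcsOutside F′ + ∑[ x < N ] (χ (S x) * outDeg x + χ (S x) * inDeg x)
      ≡⟨ cong (arcsOutside F′ +_) (sum-cong-≗ (λ x → *-distribˡ-+ (χ (S x)) (outDeg x) (inDeg x))) ⟨
    arcsOutside F′ + ∑[ x < N ] (χ (S x) * deg x)
      ∎
    where
    open ≤-Reasoning
    F′ : Fin N → Bool
    F′ x = F x ∨ S x

  arcsOutside-∪-star : ∀ F (s : Star) K → (∀ j → deg (point s j) ≤ K) →
                       arcsOutside F ≤ arcsOutside (λ x → F x ∨ inImage (point s) x) + suc D * K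
  arcsOutside-∪-star F s K deg≤K = begin
    arcsOutside F                                                     ≤⟨ arcsOutside-∪ F (inImage (point s)) ⟩
    arcsOutside F′ + ∑[ x < N ] (χ (inImage (point s) x) * deg x)      ≤⟨ +-monoʳ-≤ (arcsOutside F′) (∑-inImage (point s) deg) ⟩
    arcsOutside F′ + ∑[ j < suc D ] deg (point s j)                   ≤⟨ +-monoʳ-≤ (arcsOutside F′) (∑-mono-≤ deg≤K) ⟩
    arcsOutside F′ + ∑[ j < suc D ] K                                 ≡⟨ cong (arcsOutside F′ +_) (∑-const (suc D) K) ⟩
    arcsOutside F′ + suc D * K                                        ∎
    where
    open ≤-Reasoning
    F′ : Fin N → Bool
    F′ x = F x ∨ inImage (point s) x

  outDegOutside-fresh : ∀ F u → 0 < outDegOutside F u → T (not (F u))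
  outDegOutside-fresh F u pos =
    let w , 0<χ = ∑-positive (λ w → χ (not (F u) ∧ not (F w) ∧ A u w)) pos
    in ∧-elimˡ (not (F u)) (χ-positive (not (F u) ∧ not (F w) ∧ A u w) 0<χ)

  outDegOutside≤ : ∀ F u → outDegOutside F u ≤ ∑[ w < N ] χ (A u w ∧ not (F w))
  outDegOutside≤ F u = ∑-mono-≤ λ w → χ-mono (λ t →
    let t′ = ∧-elimʳ (not (F u)) t in
    ∧-intro (A u w) (∧-elimʳ (not (F w)) t′) (∧-elimˡ (not (F w)) t′))

  module Greedy (F₀ : Fin N → Bool) (K : ℕ) (deg≤K : ∀ x → T (not (F₀ x)) → deg x ≤ K)
                (many-arcs : N * d + D * (suc D * K) < arcsOutside F₀) where

    record Stage (r : ℕ) : Set where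
      field
        used       : Fin N → Bool
        stars      : Stars r
        stars-used : Within used stars
        F₀-used    : ∀ x → T (F₀ x) → T (used x)
        arcs-lost  : arcsOutside F₀ ≤ arcsOutside used + r * (suc D * K)

    next : ∀ {r} → r < D → Stage r → Stage (suc r)
    next {r} r<D st = record
      { used       = used′
      ; stars      = add-star s stars disjoint
      ; stars-used = λ { (zero , j) → ∨-introʳ (used (point s j)) _ (inImage-intro (point s) j)
                       ; (suc i , j) → ∨-introˡ (used (vertex stars (i , j))) _ (stars-used (i , j)) }
      ; F₀-used    = λ x t → ∨-introˡ (used x) _ (F₀-used x t)
      ; arcs-lost  = lost
      }
      where
      open Stage st
      X : ℕ
      X = suc D * K
      many-left : N * d < arcsOutside used
      many-left = +-cancelʳ-< (r * X) (N * d) (arcsOutside used) (begin-strict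
        N * d + r * X       ≤⟨ +-monoʳ-≤ (N * d) (*-monoˡ-≤ X (<⇒≤ r<D)) ⟩
        N * d + D * X       <⟨ many-arcs ⟩
        arcsOutside F₀      ≤⟨ arcs-lost ⟩
        arcsOutside used + r * X ∎)
        where open ≤-Reasoning
      pick : ∃[ u ] d < outDegOutside used u
      pick = ∑-pigeonhole (outDegOutside used) d many-left
      u : Fin N
      u = proj₁ pick
      u-fresh : T (not (used u))
      u-fresh = outDegOutside-fresh used u (<-≤-trans (s≤s z≤n) (proj₂ pick))
      found : Σ Star λ s → ∀ j → T (not (used (point s j)))
      found = star-at used u u-fresh (≤-trans (proj₂ pick) (outDegOutside≤ used u))
      s : Star
      s = proj₁ found
      used′ : Fin N → Bool
      used′ x = used x ∨ inImage (point s) x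
      disjoint : ∀ j y → point s j ≢ vertex stars y
      disjoint j y eq = T-not⇒¬T (used (point s j)) (proj₂ found j) (subst (T ∘ used) (sym eq) (stars-used y))
      new-deg≤K : ∀ j → deg (point s j) ≤ K
      new-deg≤K j = deg≤K (point s j) (not-contrapositive (F₀ (point s j)) (used (point s j)) (F₀-used (point s j)) (proj₂ found j))
      lost : arcsOutside F₀ ≤ arcsOutside used′ + suc r * X
      lost = begin
        arcsOutside F₀                  ≤⟨ arcs-lost ⟩
        arcsOutside used + r * X        ≤⟨ +-monoˡ-≤ (r * X) (arcsOutside-∪-star used s K new-deg≤K) ⟩
        arcsOutside used′ + X + r * X   ≡⟨ +-assoc (arcsOutside used′) X (r * X) ⟩
        arcsOutside used′ + suc r * X   ∎
        where open ≤-Reasoning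

    stage : ∀ r → r ≤ D → Stage r
    stage zero    _   = record
      { used = F₀ ; stars = no-stars ; stars-used = λ { (() , _) } ; F₀-used = λ _ t → t
      ; arcs-lost = ≤-reflexive (sym (+-identityʳ _)) }
    stage (suc r) r<D = next r<D (stage r (<⇒≤ r<D))

  R : ℕ
  R = D * D + D

  high : Fin N → Bool
  high x = R ≤ᵇ outDeg x

  stars-from-high : D ≤ ∑[ x < N ] χ (high x) → Stars D
  stars-from-high enough = record { vertex = vertex′ ; vertex-injective = injective ; vertex-arc = arc }
    where
    module C = SDR (distinct-representatives (λ (_ : Fin D) → high) (λ i → <-≤-trans (toℕ<n i) enough))
    owner : Fin (D * D) → Fin D
    owner p = proj₁ (remQuot D p)
    Q : Fin (D * D) → Fin N → Bool
    Q p w = A (C.rep (owner p)) w ∧ not (inImage C.rep w)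
    room : ∀ c → T (high c) → D * D ≤ ∑[ w < N ] χ (A c w ∧ not (inImage C.rep w))
    room c c-high = +-cancelʳ-≤ D (D * D) _ (begin
      R                                                                                  ≤⟨ ≤ᵇ⇒≤ R (outDeg c) c-high ⟩
      outDeg c                                                                           ≤⟨ ∑-mono-≤ (λ w → χ-split (A c w) (inImage C.rep w)) ⟩
      ∑[ w < N ] (χ (A c w ∧ not (inImage C.rep w)) + χ (inImage C.rep w))                 ≡⟨ ∑-distrib-+ (λ w → χ (A c w ∧ not (inImage C.rep w))) (λ w → χ (inImage C.rep w)) ⟩
      ∑[ w < N ] χ (A c w ∧ not (inImage C.rep w)) + ∑[ w < N ] χ (inImage C.rep w)        ≤⟨ +-monoʳ-≤ _ (∑-χ-inImage C.rep) ⟩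
      ∑[ w < N ] χ (A c w ∧ not (inImage C.rep w)) + D                                    ∎)
      where open ≤-Reasoning
    module L = SDR (distinct-representatives Q (λ p → <-≤-trans (toℕ<n p) (room (C.rep (owner p)) (C.rep-valid (owner p)))))
    leafOf : Fin D → Fin D → Fin N
    leafOf i j = L.rep (combine i j)
    vertex′ : Fin D × Fin (suc D) → Fin N
    vertex′ (i , zero)  = C.rep i
    vertex′ (i , suc j) = leafOf i j
    leaf-not-centre : ∀ i j i′ → leafOf i j ≢ C.rep i′
    leaf-not-centre i j i′ eq = T-not⇒¬T (inImage C.rep (leafOf i j)) (∧-elimʳ (A _ (leafOf i j)) (L.rep-valid (combine i j)))
                                          (subst (T ∘ inImage C.rep) (sym eq) (inImage-intro C.rep i′))
    injective : Injective _≡_ _≡_ vertex′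
    injective {i , zero}  {i′ , zero}   eq = cong (_, zero) (C.rep-injective eq)
    injective {i , zero}  {i′ , suc j′} eq = ⊥-elim (leaf-not-centre i′ j′ i (sym eq))
    injective {i , suc j} {i′ , zero}   eq = ⊥-elim (leaf-not-centre i j i′ eq)
    injective {i , suc j} {i′ , suc j′} eq with combine-injective i j i′ j′ (L.rep-injective eq)
    ... | refl , refl = refl
    arc : ∀ i j → T (A (C.rep i) (leafOf i j))
    arc i j = subst (λ c → T (A (C.rep c) (leafOf i j))) (cong proj₁ (remQuot-combine i j))
                    (∧-elimˡ (A (C.rep (owner (combine i j))) (leafOf i j)) (L.rep-valid (combine i j)))

  deg≤ : ∀ x → deg x ≤ N + N
  deg≤ x = +-mono-≤ (∑-χ≤ (A x)) (∑-χ≤ (λ u → A u x))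

  disjoint-out-stars : ∀ β → (∀ x → inDeg x ≤ outDeg x + β) →
    starThreshold N d β < arcsOutside (λ _ → false) → Stars D
  disjoint-out-stars β in≤out+β many with D ≤? ∑[ x < N ] χ (high x)
  ... | yes enough-high = stars-from-high enough-high
  ... | no  few-high    = Greedy.Stage.stars (Greedy.stage high K deg≤K many-outside-high D ≤-refl)
    where
    K : ℕ
    K = R + (R + β)
    deg≤K : ∀ x → T (not (high x)) → deg x ≤ K
    deg≤K x low = +-mono-≤ out≤R (≤-trans (in≤out+β x) (+-monoˡ-≤ β out≤R))
      where
      out≤R : outDeg x ≤ R
      out≤R = <⇒≤ (≰⇒> (T-not⇒¬T (high x) low ∘ ≤⇒≤ᵇ))
    arcs-at-high : ∑[ x < N ] (χ (high x) * deg x) ≤ d * (N + N)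
    arcs-at-high = begin
      ∑[ x < N ] (χ (high x) * deg x)       ≤⟨ ∑-mono-≤ (λ x → *-monoʳ-≤ (χ (high x)) (deg≤ x)) ⟩
      ∑[ x < N ] (χ (high x) * (N + N))     ≡⟨ *-distribʳ-sum (N + N) (χ ∘ high) ⟨
      ∑[ x < N ] χ (high x) * (N + N)       ≤⟨ *-monoˡ-≤ (N + N) (≤-pred (≰⇒> few-high)) ⟩
      d * (N + N)                           ∎
      where open ≤-Reasoning
    many-outside-high : N * d + D * (suc D * K) < arcsOutside high
    many-outside-high = +-cancelʳ-< (d * (N + N)) _ _
      (<-≤-trans many (≤-trans (arcsOutside-∪ (λ _ → false) high) (+-monoʳ-≤ (arcsOutside high) arcs-at-high)))

-- Links of a 3-graph

∣p∣≡0⇒p≡⊥ : ∀ {n} (p : Subset n) → ∣ p ∣ ≡ 0 → p ≡ ⊥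
∣p∣≡0⇒p≡⊥ []          _  = refl
∣p∣≡0⇒p≡⊥ (false ∷ p) eq = cong (false ∷_) (∣p∣≡0⇒p≡⊥ p eq)

∣p∣≡1⇒singleton : ∀ {n} (p : Subset n) → ∣ p ∣ ≡ 1 → ∃[ x ] p ≡ ⁅ x ⁆
∣p∣≡1⇒singleton (true ∷ p) eq = zero , cong (true ∷_) (∣p∣≡0⇒p≡⊥ p (suc-injective eq))
∣p∣≡1⇒singleton (false ∷ p) eq with x , refl ← ∣p∣≡1⇒singleton p eq = suc x , refl

∣p∣≡2⇒pair : ∀ {n} (p : Subset n) → ∣ p ∣ ≡ 2 → ∃[ x ] ∃[ y ] x ≢ y × p ≡ ⁅ x ⁆ ∪ ⁅ y ⁆
∣p∣≡2⇒pair (true ∷ p) eq with y , refl ← ∣p∣≡1⇒singleton p (suc-injective eq) =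
  zero , suc y , (λ ()) , cong (true ∷_) (sym (∪-identityˡ ⁅ y ⁆))
∣p∣≡2⇒pair (false ∷ p) eq with x , y , x≢y , refl ← ∣p∣≡2⇒pair p eq =
  suc x , suc y , x≢y ∘ Fin.suc-injective , refl

∣p∣≡3⇒triple : ∀ {n} (p : Subset n) → ∣ p ∣ ≡ 3 →
               ∃[ x ] ∃[ y ] ∃[ z ] x ≢ y × y ≢ z × x ≢ z × p ≡ triple x y z
∣p∣≡3⇒triple (true ∷ p) eq with y , z , y≢z , refl ← ∣p∣≡2⇒pair p (suc-injective eq) =
  zero , suc y , suc z , (λ ()) , y≢z ∘ Fin.suc-injective , (λ ()) , cong (true ∷_) (sym (∪-identityˡ (⁅ y ⁆ ∪ ⁅ z ⁆)))
∣p∣≡3⇒triple (false ∷ p) eq with x , y , z , x≢y , y≢z , x≢z , refl ← ∣p∣≡3⇒triple p eq =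
  suc x , suc y , suc z , x≢y ∘ Fin.suc-injective , y≢z ∘ Fin.suc-injective , x≢z ∘ Fin.suc-injective , refl

module _ {N : ℕ} {X : Set} (_≟ₓ_ : DecidableEquality X) (code : Fin N → Fin N → Fin N → X)
         (P : Fin N → Fin N → Fin N → Bool) where

  open import Data.List.Membership.DecPropositional _≟ₓ_ using (_∈?_)

  Coded : List X → Set
  Coded xs = ∀ s → s ∈ xs → ∃[ x ] ∃[ y ] ∃[ z ] T (P x y z) × code x y z ≡ s

  unique-length≤ : ∀ xs → Unique xs → Coded xs → length xs ≤ ∑[ x < N ] ∑[ y < N ] ∑[ z < N ] χ (P x y z)
  unique-length≤ xs uniq coded =
    ≤-trans (counted xs uniq coded) (∑-mono-≤ λ x → ∑-mono-≤ λ y → ∑-mono-≤ λ z → χ-mono (∧-elimˡ (P x y z)))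
    where
    listed : List X → Fin N → Fin N → Fin N → Bool
    listed xs x y z = P x y z ∧ does (code x y z ∈? xs)
    counted : ∀ xs → Unique xs → Coded xs → length xs ≤ ∑[ x < N ] ∑[ y < N ] ∑[ z < N ] χ (listed xs x y z)
    counted []       _              _     = z≤n
    counted (s ∷ xs) (s∉xs ∷ uniq) coded with coded s (here refl)
    ... | x₀ , y₀ , z₀ , P₀ , refl =
      ≤-trans (s≤s (counted xs uniq (λ t t∈xs → coded t (there t∈xs))))
              (∑-mono-< (λ x → ∑-mono-≤ λ y → ∑-mono-≤ (more x y)) x₀
                (∑-mono-< (λ y → ∑-mono-≤ (more x₀ y)) y₀ (∑-mono-< (more x₀ y₀) z₀ new)))
      where
      more : ∀ x y z → χ (listed xs x y z) ≤ χ (listed (s ∷ xs) x y z)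
      more x y z = χ-mono λ t → ∧-intro (P x y z) (∧-elimˡ (P x y z) t)
        (⇒does (code x y z ∈? s ∷ xs) (there (does⇒ (code x y z ∈? xs) (∧-elimʳ (P x y z) t))))
      new : χ (listed xs x₀ y₀ z₀) < χ (listed (s ∷ xs) x₀ y₀ z₀)
      new = χ-strict (listed xs x₀ y₀ z₀) (listed (s ∷ xs) x₀ y₀ z₀)
        (λ t → All.lookup s∉xs (does⇒ (s ∈? xs) (∧-elimʳ (P x₀ y₀ z₀) t)) refl)
        (∧-intro (P x₀ y₀ z₀) P₀ (⇒does (s ∈? s ∷ xs) (here refl)))

triple-swap : ∀ {n} (a x y : Fin n) → triple a x y ≡ triple a y x
triple-swap a x y = cong (⁅ a ⁆ ∪_) (∪-comm ⁅ x ⁆ ⁅ y ⁆)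

triple-rotate : ∀ {n} (x y z : Fin n) → triple y z x ≡ triple x y z
triple-rotate x y z = begin
  ⁅ y ⁆ ∪ (⁅ z ⁆ ∪ ⁅ x ⁆) ≡⟨ cong (⁅ y ⁆ ∪_) (∪-comm ⁅ z ⁆ ⁅ x ⁆) ⟩
  ⁅ y ⁆ ∪ (⁅ x ⁆ ∪ ⁅ z ⁆) ≡⟨ ∪-assoc ⁅ y ⁆ ⁅ x ⁆ ⁅ z ⁆ ⟨
  (⁅ y ⁆ ∪ ⁅ x ⁆) ∪ ⁅ z ⁆ ≡⟨ cong (_∪ ⁅ z ⁆) (∪-comm ⁅ y ⁆ ⁅ x ⁆) ⟩
  (⁅ x ⁆ ∪ ⁅ y ⁆) ∪ ⁅ z ⁆ ≡⟨ ∪-assoc ⁅ x ⁆ ⁅ y ⁆ ⁅ z ⁆ ⟩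
  ⁅ x ⁆ ∪ (⁅ y ⁆ ∪ ⁅ z ⁆) ∎
  where open ≡-Reasoning

∑³-χ-∧ : ∀ {n} (B : Fin n → Bool) →
         ∑[ x < n ] ∑[ y < n ] ∑[ z < n ] χ (B x ∧ B y ∧ B z) ≡ (∑[ x < n ] χ (B x)) ^ 3
∑³-χ-∧ {n} B = begin
  ∑[ x < n ] ∑[ y < n ] ∑[ z < n ] χ (B x ∧ B y ∧ B z)
    ≡⟨ sum-cong-≗ (λ x → sum-cong-≗ λ y → sum-cong-≗ λ z → trans (χ-∧ (B x) _) (cong (χ (B x) *_) (χ-∧ (B y) (B z)))) ⟩
  ∑[ x < n ] ∑[ y < n ] ∑[ z < n ] (χ (B x) * (χ (B y) * χ (B z)))
    ≡⟨ sum-cong-≗ (λ x → sum-cong-≗ λ y → trans (cong (χ (B x) *_) (*-distribˡ-sum (χ (B y)) (χ ∘ B))) (*-distribˡ-sum (χ (B x)) (λ z → χ (B y) * χ (B z)))) ⟨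
  ∑[ x < n ] ∑[ y < n ] (χ (B x) * (χ (B y) * β))
    ≡⟨ sum-cong-≗ (λ x → trans (cong (χ (B x) *_) (*-distribʳ-sum β (χ ∘ B))) (*-distribˡ-sum (χ (B x)) (λ y → χ (B y) * β))) ⟨
  ∑[ x < n ] (χ (B x) * (β * β))
    ≡⟨ *-distribʳ-sum (β * β) (χ ∘ B) ⟨
  β * (β * β)
    ≡⟨ cong (λ b → β * (β * b)) (*-identityʳ β) ⟨
  β ^ 3 ∎
  where
  open ≡-Reasoning
  β : ℕ
  β = ∑[ x < n ] χ (B x)

starIndex : ∀ {h k} → Fin h ⊎ (Fin h × Fin k) → Fin h × Fin (suc k)
starIndex (inj₁ i)       = i , zero
starIndex (inj₂ (i , j)) = i , suc j

starIndex-injective : ∀ {h k} → Injective _≡_ _≡_ (starIndex {h} {k})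
starIndex-injective {x = inj₁ _}       {inj₁ _}       refl = refl
starIndex-injective {x = inj₂ (_ , _)} {inj₂ (_ , _)} refl = refl

StCopy-mono : ∀ {N} {H : 3Graph N} {h k} {P Q : Fin N → Set} → (∀ x → P x → Q x) → StCopy H h k P → StCopy H h k Q
StCopy-mono P⇒Q copy = record
  { emb = emb ; emb-inj = emb-inj ; emb-edges = emb-edges ; leaves-in-P = λ i j → P⇒Q _ (leaves-in-P i j) }
  where open StCopy copy

module Link {N : ℕ} (H : 3Graph N) (inB : Fin N → Bool) where

  open import Data.List.Membership.DecPropositional (≡-dec {n = N} Bool._≟_) using (_∈?_)

  record LinkArc (v u w : Fin N) : Set where
    constructor linkArc
    field
      leaf∉B      : ¬ T (inB w)
      centre≢leaf : u ≢ w
      centre≢apex : u ≢ v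
      leaf≢apex   : w ≢ v
      edge        : triple v u w ∈ edges H

  linkArc? : ∀ v u w → Dec (LinkArc v u w)
  linkArc? v u w = map′ (λ (a , b , c , d , e) → linkArc a b c d e) (λ (linkArc a b c d e) → a , b , c , d , e)
    (¬? (T? (inB w)) ×-dec ¬? (u ≟ w) ×-dec ¬? (u ≟ v) ×-dec ¬? (w ≟ v) ×-dec triple v u w ∈? edges H)

  link : Fin N → Fin N → Fin N → Bool
  link v u w = does (linkArc? v u w)

  link-irreflexive : ∀ v u → ¬ T (link v u u)
  link-irreflexive v u t = LinkArc.centre≢leaf (does⇒ (linkArc? v u u) t) refl

  link-reverse : ∀ v u x → T (link v u x) → T (link v x u) ⊎ T (inB u)
  link-reverse v u x t with T? (inB u) | does⇒ (linkArc? v u x) t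
  ... | yes u∈B | _                        = inj₂ u∈B
  ... | no  u∉B | linkArc _ u≢x u≢v x≢v e =
    inj₁ (⇒does (linkArc? v x u) (linkArc u∉B (u≢x ∘ sym) x≢v u≢v (subst (_∈ edges H) (triple-swap v u x) e)))

  link-inDeg≤ : ∀ v x → ∑[ u < N ] χ (link v u x) ≤ ∑[ u < N ] χ (link v x u) + ∑[ u < N ] χ (inB u)
  link-inDeg≤ v x = ≤-trans (∑-mono-≤ (λ u → χ-mono-⊎ (link v u x) (link v x u) (inB u) (link-reverse v u x)))
                            (≤-reflexive (∑-distrib-+ (λ u → χ (link v x u)) (χ ∘ inB)))

  allB : Fin N → Fin N → Fin N → Bool
  allB x y z = inB x ∧ inB y ∧ inB z

  edges-coded : Coded (≡-dec {n = N} Bool._≟_) triple (λ x y z → link x y z ∨ allB x y z) (edges H)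
  edges-coded s s∈E with ∣p∣≡3⇒triple s (All.lookup (size3 H) s∈E)
  ... | x , y , z , x≢y , y≢z , x≢z , refl with T? (inB z) | T? (inB y) | T? (inB x)
  ... | no z∉B | _ | _ =
    x , y , z , ∨-introˡ (link x y z) _ (⇒does (linkArc? x y z) (linkArc z∉B y≢z (x≢y ∘ sym) (x≢z ∘ sym) s∈E)) , refl
  ... | yes _ | no y∉B | _ =
    x , z , y , ∨-introˡ (link x z y) _ (⇒does (linkArc? x z y)
      (linkArc y∉B (y≢z ∘ sym) (x≢z ∘ sym) (x≢y ∘ sym) (subst (_∈ edges H) (triple-swap x y z) s∈E))) , triple-swap x z y
  ... | yes _ | yes _ | no x∉B =
    y , z , x , ∨-introˡ (link y z x) _ (⇒does (linkArc? y z x)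
      (linkArc x∉B (x≢z ∘ sym) (y≢z ∘ sym) x≢y (subst (_∈ edges H) (sym (triple-rotate x y z)) s∈E))) , triple-rotate x y z
  ... | yes x∈B | yes y∈B | yes z∈B =
    x , y , z , ∨-introʳ (link x y z) _ (∧-intro (inB x) z∈B (∧-intro (inB y) y∈B x∈B)) , refl

  numEdges≤ : numEdges H ≤ ∑[ v < N ] ∑[ u < N ] ∑[ w < N ] χ (link v u w) + (∑[ x < N ] χ (inB x)) ^ 3
  numEdges≤ = begin
    numEdges H
      ≤⟨ unique-length≤ (≡-dec Bool._≟_) triple (λ x y z → link x y z ∨ allB x y z) (edges H) (distinct H) edges-coded ⟩
    ∑[ x < N ] ∑[ y < N ] ∑[ z < N ] χ (link x y z ∨ allB x y z)
      ≤⟨ ∑-mono-≤ (λ x → ∑-mono-≤ λ y → ∑-mono-≤ λ z → χ-∨ (link x y z) (allB x y z)) ⟩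
    ∑[ x < N ] ∑[ y < N ] ∑[ z < N ] (χ (link x y z) + χ (allB x y z))
      ≡⟨ sum-cong-≗ (λ x → trans
           (sum-cong-≗ λ y → ∑-distrib-+ (λ z → χ (link x y z)) (λ z → χ (allB x y z)))
           (∑-distrib-+ (λ y → ∑[ z < N ] χ (link x y z)) (λ y → ∑[ z < N ] χ (allB x y z)))) ⟩
    ∑[ x < N ] (∑[ y < N ] ∑[ z < N ] χ (link x y z) + ∑[ y < N ] ∑[ z < N ] χ (allB x y z))
      ≡⟨ ∑-distrib-+ (λ x → ∑[ y < N ] ∑[ z < N ] χ (link x y z)) (λ x → ∑[ y < N ] ∑[ z < N ] χ (allB x y z)) ⟩
    ∑[ x < N ] ∑[ y < N ] ∑[ z < N ] χ (link x y z) + ∑[ x < N ] ∑[ y < N ] ∑[ z < N ] χ (allB x y z)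
      ≡⟨ cong (∑[ x < N ] ∑[ y < N ] ∑[ z < N ] χ (link x y z) +_) (∑³-χ-∧ inB) ⟩
    ∑[ v < N ] ∑[ u < N ] ∑[ w < N ] χ (link v u w) + (∑[ x < N ] χ (inB x)) ^ 3 ∎
    where open ≤-Reasoning

  link-stars⇒StCopy : ∀ v d → DisjointOutStars.Stars (link v) (link-irreflexive v) d (suc d) →
                      StCopy H (suc d) (suc d) (λ x → ¬ T (inB x))
  link-stars⇒StCopy v d stars = record
    { emb = emb ; emb-inj = emb-inj ; emb-edges = λ i j → LinkArc.edge (arc i j) ; leaves-in-P = λ i j → LinkArc.leaf∉B (arc i j) }
    where
    open DisjointOutStars.Stars stars
    arc : ∀ i j → LinkArc v (vertex (i , zero)) (vertex (i , suc j))
    arc i j = does⇒ (linkArc? v _ _) (vertex-arc i j)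
    apex-fresh : ∀ y → vertex y ≢ v
    apex-fresh (i , zero)  = LinkArc.centre≢apex (arc i zero)
    apex-fresh (i , suc j) = LinkArc.leaf≢apex (arc i j)
    emb : StVertex (suc d) (suc d) → Fin N
    emb (inj₁ _) = v
    emb (inj₂ y) = vertex (starIndex y)
    emb-inj : Injective _≡_ _≡_ emb
    emb-inj {inj₁ _} {inj₁ _} _  = refl
    emb-inj {inj₁ _} {inj₂ y} eq = ⊥-elim (apex-fresh (starIndex y) (sym eq))
    emb-inj {inj₂ x} {inj₁ _} eq = ⊥-elim (apex-fresh (starIndex x) eq)
    emb-inj {inj₂ x} {inj₂ y} eq = cong inj₂ (starIndex-injective (vertex-injective eq))

  St-in-dense-3graph : ∀ β d → ∑[ x < N ] χ (inB x) ≤ β → β ^ 3 + N * starThreshold N d β < numEdges H →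
                       StCopy H (suc d) (suc d) (λ x → ¬ T (inB x))
  St-in-dense-3graph β d #B≤β many-edges = link-stars⇒StCopy v d
    (DisjointOutStars.disjoint-out-stars (link v) (link-irreflexive v) d β
      (λ x → ≤-trans (link-inDeg≤ v x) (+-monoʳ-≤ _ #B≤β)) rich)
    where
    arcs : Fin N → ℕ
    arcs v = ∑[ u < N ] ∑[ w < N ] χ (link v u w)
    many-arcs : N * starThreshold N d β < ∑[ v < N ] arcs v
    many-arcs = +-cancelʳ-< (β ^ 3) _ _ (begin-strict
      N * starThreshold N d β + β ^ 3                    ≡⟨ +-comm _ (β ^ 3) ⟩
      β ^ 3 + N * starThreshold N d β                    <⟨ many-edges ⟩
      numEdges H                                         ≤⟨ numEdges≤ ⟩
      ∑[ v < N ] arcs v + (∑[ x < N ] χ (inB x)) ^ 3     ≤⟨ +-monoʳ-≤ (∑[ v < N ] arcs v) (^-monoˡ-≤ 3 #B≤β) ⟩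
      ∑[ v < N ] arcs v + β ^ 3                          ∎)
      where open ≤-Reasoning
    pick : ∃[ v ] starThreshold N d β < arcs v
    pick = ∑-pigeonhole arcs (starThreshold N d β) many-arcs
    v : Fin N
    v = proj₁ pick
    rich : starThreshold N d β < arcs v
    rich = proj₂ pick

-- Arithmetic of the parameters

^-cancelˡ-≤ : ∀ n .{{_ : NonZero n}} {x y} → x ^ n ≤ y ^ n → x ≤ y
^-cancelˡ-≤ n {x} {y} xⁿ≤yⁿ with x ≤? y
... | yes x≤y = x≤y
... | no  x≰y = contradiction xⁿ≤yⁿ (<⇒≱ (^-monoˡ-< n (≰⇒> x≰y)))

^-cancelˡ-< : ∀ n {x y} → x ^ n < y ^ n → x < y
^-cancelˡ-< n {x} {y} xⁿ<yⁿ with suc x ≤? y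
... | yes x<y = x<y
... | no  x≮y = contradiction xⁿ<yⁿ (≤⇒≯ (^-monoˡ-≤ n (≮⇒≥ x≮y)))

square-root-bound : ∀ {n k t D} .{{_ : NonZero k}} → t ^ 6 * k ≤ n → n < suc D ^ 3 * k → t * t ≤ D
square-root-bound {n} {k} {t} {D} t⁶k≤n n<[D+1]³k = ≤-pred (^-cancelˡ-< 3 (subst (_< suc D ^ 3) (sixth t)
  (*-cancelʳ-< k (t ^ 6) (suc D ^ 3) (≤-<-trans t⁶k≤n n<[D+1]³k))))
  where
  sixth : ∀ t → t * (t * (t * (t * (t * (t * 1))))) ≡ (t * t) * ((t * t) * ((t * t) * 1))
  sixth = solve-∀

module EdgeBudget {n k t d b c : ℕ} {{k≢0 : NonZero k}} {{t≢0 : NonZero t}}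
                  (D³k≤n : suc d ^ 3 * k ≤ n) (n<[D+1]³k : n < suc (suc d) ^ 3 * k) (t≤k : t ≤ k) (t⁶k≤n : t ^ 6 * k ≤ n)
                  (b-small : b ^ 3 * k ^ 2 ≤ 4096 * t ^ 3 * n ^ 2) (c-small : c ^ 3 ≤ 4096 * t ^ 3 * n ^ 2 * k) where

  D N tD² W : ℕ
  D = suc d
  N = b + c
  tD² = t * (D * D)
  W = D * D * D * (D * D * D) * (k * k * k)

  1≤k : 1 ≤ k
  1≤k = >-nonZero⁻¹ k

  t²≤D : t * t ≤ D
  t²≤D = square-root-bound {n} {k} {t} {D} t⁶k≤n n<[D+1]³k

  n≤8D³k : n ≤ 8 * (D * D * D) * k
  n≤8D³k = ≤-trans (<⇒≤ n<[D+1]³k) (*-monoˡ-≤ k (≤-trans (^-monoˡ-≤ 3 D+1≤D+D) (≤-reflexive (cube-double D))))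
    where
    D+1≤D+D : suc D ≤ D + D
    D+1≤D+D = subst (_≤ D + D) (+-comm D 1) (+-monoʳ-≤ D (s≤s z≤n))
    cube-double : ∀ D → (D + D) * ((D + D) * ((D + D) * 1)) ≡ 8 * (D * D * D)
    cube-double = solve-∀

  b≤64tD² : b ≤ 64 * tD²
  b≤64tD² = ^-cancelˡ-≤ 3 (*-cancelʳ-≤ (b ^ 3) ((64 * tD²) ^ 3) (k ^ 2) {{m^n≢0 k 2}} (begin
    b ^ 3 * k ^ 2                              ≤⟨ b-small ⟩
    4096 * t ^ 3 * n ^ 2                       ≤⟨ *-monoʳ-≤ (4096 * t ^ 3) (^-monoˡ-≤ 2 n≤8D³k) ⟩
    4096 * t ^ 3 * (8 * (D * D * D) * k) ^ 2   ≡⟨ expand 8 t D k ⟩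
    (64 * tD²) ^ 3 * k ^ 2                       ∎))
    where
    open ≤-Reasoning
    -- Constants enter as variables (here e = 8): the ring solver is slow on large literals.
    expand : ∀ e t D k → e * e * e * e * (t * (t * (t * 1))) * ((e * (D * D * D) * k) * ((e * (D * D * D) * k) * 1))
                       ≡ (e * e * (t * (D * D))) * ((e * e * (t * (D * D))) * ((e * e * (t * (D * D))) * 1)) * (k * (k * 1))
    expand = solve-∀

  c≤64tD²k : c ≤ 64 * tD² * k
  c≤64tD²k = ^-cancelˡ-≤ 3 (begin
    c ^ 3                                          ≤⟨ c-small ⟩
    4096 * t ^ 3 * n ^ 2 * k                       ≤⟨ *-monoˡ-≤ k (*-monoʳ-≤ (4096 * t ^ 3) (^-monoˡ-≤ 2 n≤8D³k)) ⟩
    4096 * t ^ 3 * (8 * (D * D * D) * k) ^ 2 * k   ≡⟨ expand 8 t D k ⟩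
    (64 * tD² * k) ^ 3                               ∎)
    where
    open ≤-Reasoning
    expand : ∀ e t D k → e * e * e * e * (t * (t * (t * 1))) * ((e * (D * D * D) * k) * ((e * (D * D * D) * k) * 1)) * k
                       ≡ (e * e * (t * (D * D)) * k) * ((e * e * (t * (D * D)) * k) * ((e * e * (t * (D * D)) * k) * 1))
    expand = solve-∀

  N≤128tD²k : N ≤ 128 * (tD² * k)
  N≤128tD²k = ≤-trans (+-mono-≤ (≤-trans b≤64tD² (m≤m*n (64 * tD²) k)) c≤64tD²k) (≤-reflexive (double tD² k))
    where
    double : ∀ tD² k → 64 * tD² * k + 64 * tD² * k ≡ 128 * (tD² * k)
    double = solve-∀

  threshold≤ : starThreshold N d b ≤ 3 * (N * D) + D * ((D + D) * (68 * tD²))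
  threshold≤ = begin
    N * d + D * (suc D * (R + (R + b))) + d * (N + N)
      ≤⟨ +-mono-≤ (+-mono-≤ (*-monoʳ-≤ N (n≤1+n d)) (*-monoʳ-≤ D (*-mono-≤ D+1≤D+D R+R+b≤68tD²))) (*-monoˡ-≤ (N + N) (n≤1+n d)) ⟩
    N * D + D * ((D + D) * (68 * tD²)) + D * (N + N)
      ≡⟨ collect N D (D * ((D + D) * (68 * tD²))) ⟩
    3 * (N * D) + D * ((D + D) * (68 * tD²)) ∎
    where
    open ≤-Reasoning
    R : ℕ
    R = D * D + D
    D+1≤D+D : suc D ≤ D + D
    D+1≤D+D = subst (_≤ D + D) (+-comm D 1) (+-monoʳ-≤ D (s≤s z≤n))
    D²≤tD² : D * D ≤ tD²
    D²≤tD² = m≤n*m (D * D) t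
    R+R+b≤68tD² : R + (R + b) ≤ 68 * tD²
    R+R+b≤68tD² = ≤-trans (+-mono-≤ R≤2tD² (+-mono-≤ R≤2tD² b≤64tD²)) (≤-reflexive (sixty-eight tD²))
      where
      R≤2tD² : R ≤ tD² + tD²
      R≤2tD² = +-mono-≤ D²≤tD² (≤-trans (m≤m*n D D) D²≤tD²)
      sixty-eight : ∀ tD² → tD² + tD² + (tD² + tD² + 64 * tD²) ≡ 68 * tD²
      sixty-eight = solve-∀
    collect : ∀ N D Y → N * D + Y + D * (N + N) ≡ 3 * (N * D) + Y
    collect = solve-∀

  b³≤ : b ^ 3 ≤ (64 * 64 * 64) * W
  b³≤ = ≤-trans (^-monoˡ-≤ 3 (≤-trans b≤64tD² (*-monoʳ-≤ 64 (*-monoˡ-≤ (D * D) t≤k)))) (≤-reflexive (expand 64 k D))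
    where
    expand : ∀ a k D → (a * (k * (D * D))) * ((a * (k * (D * D))) * ((a * (k * (D * D))) * 1))
                     ≡ (a * a * a) * (D * D * D * (D * D * D) * (k * k * k))
    expand = solve-∀

  N²D≤ : N * (3 * (N * D)) ≤ (3 * 128 * 128) * W
  N²D≤ = begin
    N * (3 * (N * D))                                          ≤⟨ *-mono-≤ N≤128tD²k (*-monoʳ-≤ 3 (*-monoˡ-≤ D N≤128tD²k)) ⟩
    (128 * (tD² * k)) * (3 * ((128 * (tD² * k)) * D))              ≡⟨ expand 128 3 t D k ⟩
    (3 * 128 * 128) * ((t * t) * (D * D * D * D * D) * (k * k)) ≤⟨ *-monoʳ-≤ (3 * 128 * 128) (*-mono-≤ (*-monoˡ-≤ (D * D * D * D * D) t²≤D) (m≤m*n (k * k) k)) ⟩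
    (3 * 128 * 128) * (D * (D * D * D * D * D) * (k * k * k))  ≡⟨ cong ((3 * 128 * 128) *_) (regroup D k) ⟩
    (3 * 128 * 128) * W                                        ∎
    where
    open ≤-Reasoning
    expand : ∀ a c t D k → (a * (t * (D * D) * k)) * (c * ((a * (t * (D * D) * k)) * D))
                         ≡ (c * a * a) * ((t * t) * (D * D * D * D * D) * (k * k))
    expand = solve-∀
    regroup : ∀ D k → D * (D * D * D * D * D) * (k * k * k) ≡ D * D * D * (D * D * D) * (k * k * k)
    regroup = solve-∀

  NDtD²≤ : N * (D * ((D + D) * (68 * tD²))) ≤ (256 * 68) * W
  NDtD²≤ = begin
    N * (D * ((D + D) * (68 * tD²)))                               ≤⟨ *-monoˡ-≤ (D * ((D + D) * (68 * tD²))) N≤128tD²k ⟩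
    (128 * (tD² * k)) * (D * ((D + D) * (68 * tD²)))                 ≡⟨ expand 128 68 t D k ⟩
    (256 * 68) * ((t * t) * (D * D * D * (D * D * D)) * k)       ≤⟨ *-monoʳ-≤ (256 * 68) (*-monoˡ-≤ k (*-monoˡ-≤ (D * D * D * (D * D * D)) (*-mono-≤ t≤k t≤k))) ⟩
    (256 * 68) * ((k * k) * (D * D * D * (D * D * D)) * k)       ≡⟨ cong ((256 * 68) *_) (regroup D k) ⟩
    (256 * 68) * W                                               ∎
    where
    open ≤-Reasoning
    expand : ∀ a e t D k → (a * (t * (D * D) * k)) * (D * ((D + D) * (e * (t * (D * D)))))
                         ≡ ((a + a) * e) * ((t * t) * (D * D * D * (D * D * D)) * k)
    expand = solve-∀
    regroup : ∀ D k → (k * k) * (D * D * D * (D * D * D)) * k ≡ D * D * D * (D * D * D) * (k * k * k)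
    regroup = solve-∀

  W≤kn² : W ≤ k * n ^ 2
  W≤kn² = ≤-trans (≤-reflexive (regroup D k)) (*-monoʳ-≤ k (^-monoˡ-≤ 2 D³k≤n))
    where
    regroup : ∀ D k → D * D * D * (D * D * D) * (k * k * k) ≡ k * ((D * (D * (D * 1)) * k) * ((D * (D * (D * 1)) * k) * 1))
    regroup = solve-∀

  1≤W : 1 ≤ W
  1≤W = *-mono-≤ (*-mono-≤ (*-mono-≤ (*-mono-≤ 1≤D 1≤D) 1≤D) (*-mono-≤ (*-mono-≤ 1≤D 1≤D) 1≤D)) (*-mono-≤ (*-mono-≤ 1≤k 1≤k) 1≤k)
    where
    1≤D : 1 ≤ D
    1≤D = s≤s z≤n

  edge-budget : suc (b ^ 3 + N * starThreshold N d b) ≤ 328705 * k * n ^ 2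
  edge-budget = begin
    suc (b ^ 3 + N * starThreshold N d b)
      ≤⟨ s≤s (+-monoʳ-≤ (b ^ 3) (≤-trans (*-monoʳ-≤ N threshold≤) (≤-reflexive (*-distribˡ-+ N _ _)))) ⟩
    suc (b ^ 3 + (N * (3 * (N * D)) + N * (D * ((D + D) * (68 * tD²)))))
      ≤⟨ s≤s (+-mono-≤ b³≤ (+-mono-≤ N²D≤ NDtD²≤)) ⟩
    suc ((64 * 64 * 64) * W + ((3 * 128 * 128) * W + (256 * 68) * W))
      ≡⟨ cong suc (collect W) ⟩
    suc (328704 * W)
      ≤⟨ +-monoˡ-≤ (328704 * W) 1≤W ⟩
    328705 * W
      ≤⟨ *-monoʳ-≤ 328705 W≤kn² ⟩
    328705 * (k * n ^ 2)
      ≡⟨ *-assoc 328705 k (n ^ 2) ⟨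
    328705 * k * n ^ 2 ∎
    where
    open ≤-Reasoning
    collect : ∀ W → (64 * 64 * 64) * W + ((3 * 128 * 128) * W + (256 * 68) * W) ≡ 328704 * W
    collect = solve-∀

lemma5p5 : Σ ℕ λ C →
    (n k t : ℕ) → NonZero n → NonZero k → NonZero t →
    -- D = ⌊ d ⌋ where d = (n/k)^(1/3)
    (D : ℕ) → D ^ 3 * k ≤ n → n < suc D ^ 3 * k →
    -- t ≤ k and t ≤ √d  (i.e. t^6 ≤ n/k)
    t ≤ k → t ^ 6 * k ≤ n →
    -- |B| = b ≤ 16 t d² and |C₀| = c ≤ 16 t d² k  (cubed to avoid real roots)
    (b c : ℕ) → b ^ 3 * k ^ 2 ≤ 4096 * t ^ 3 * n ^ 2 →
    c ^ 3 ≤ 4096 * t ^ 3 * n ^ 2 * k →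
    (H : 3Graph (b + c)) → C * k * n ^ 2 ≤ numEdges H →
    StCopy H D D (InC₀ b)
lemma5p5 = 328705 , λ where
  n k t _ k≢0 t≢0 zero D³k≤n n<[D+1]³k t≤k t⁶k≤n b c b-small c-small H many-edges →
    contradiction (square-root-bound {n} {k} {t} {zero} {{k≢0}} t⁶k≤n n<[D+1]³k)
                  (<⇒≱ (>-nonZero⁻¹ (t * t) {{m*n≢0 t t {{t≢0}} {{t≢0}}}}))
  n k t _ k≢0 t≢0 (suc d) D³k≤n n<[D+1]³k t≤k t⁶k≤n b c b-small c-small H many-edges →
    let open EdgeBudget {n} {k} {t} {d} {b} {c} {{k≢0}} {{t≢0}} D³k≤n n<[D+1]³k t≤k t⁶k≤n b-small c-small in
    StCopy-mono (λ x x∉B → ≮⇒≥ (x∉B ∘ <⇒<ᵇ))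
      (Link.St-in-dense-3graph H (λ x → toℕ x <ᵇ b) b d (#below≤ (b + c) b) (≤-trans edge-budget many-edges))
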